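{- For all integers $i\ge 1$, the number of indices $n\ge 0$ with $S_F(n)=i$ is finite. Moreover, if $n_i$ denotes the largest index $n$ such that $S_F(n)=i$, then $n_i=F(i-2)$ for all $i\ge 5$.
   Context: Let $(F(n))_{n\ge 0}$ be defined by $F(0)=1$, $F(1)=2$, $F(n+2)=F(n+1)+F(n)$. For $n\ge 1$, $\mathrm{rep}_F(n)$ is the greedy (Zeckendorf) representation of $n$: the word $c_{\ell-1}\cdots c_0$ over $\{0,1\}$ with $c_{\ell-1}=1$, no factor $11$, and $n=\sum_j c_jF(j)$; $\mathrm{rep}_F(0)=\varepsilon$. Let $L_F=\{\varepsilon\}\cup 1\{0,01\}^*$. For words $u,v$, $\binom{u}{v}$ is the number of occurrences of $v$ as a scattered subword (subsequence) of $u$, and $S_F(n)=\#\{v\in L_F : \binom{\mathrm{rep}_F(n)}{v}>0\}$. -}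

module Defs where

open import Data.Nat using (ℕ; zero; suc; _+_; _∸_; _≤ᵇ_; _<ᵇ_)
open import Data.Bool using (Bool; true; false; if_then_else_; _∧_; _∨_; not)
open import Data.List using (List; []; _∷_; _++_; map; concatMap; upTo; length; filterᵇ)

F : ℕ → ℕ
F zero = 1
F (suc zero) = 2
F (suc (suc n)) = F (suc n) + F n

-- Words over {0,1}: false = 0, true = 1; most significant digit first.
Word : Set
Word = List Bool

-- Greedy digits: given ℓ, produce c_{ℓ-1} ⋯ c_0 for n (assumed n < F ℓ).
greedyDigits : ℕ → ℕ → Word
greedyDigits zero n = []
greedyDigits (suc ℓ) n =
  if F ℓ ≤ᵇ n then true ∷ greedyDigits ℓ (n ∸ F ℓ)
              else false ∷ greedyDigits ℓ n

dropLeadingZeros : Word → Word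
dropLeadingZeros [] = []
dropLeadingZeros (false ∷ w) = dropLeadingZeros w
dropLeadingZeros (true ∷ w) = true ∷ w

-- rep_F(n): greedy (Zeckendorf) representation; F(n+1) > n, so n+1 digits suffice.
-- rep_F(0) = ε.
repF : ℕ → Word
repF n = dropLeadingZeros (greedyDigits (suc n) n)

binom : Word → Word → ℕ
binom u [] = 1
binom [] (b ∷ v) = 0
binom (a ∷ u) (b ∷ v) =
  binom u (b ∷ v) + (if eqB a b then binom u v else 0)
  where
  eqB : Bool → Bool → Bool
  eqB true true = true
  eqB false false = true
  eqB _ _ = false

-- membership in {0,01}*
inTail : Word → Bool
inTail [] = true
inTail (false ∷ true ∷ w) = inTail w ∨ inTail (true ∷ w)
inTail (false ∷ w) = inTail w
inTail (true ∷ w) = false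

inLF : Word → Bool
inLF [] = true
inLF (true ∷ w) = inTail w
inLF (false ∷ w) = false

wordsOfLen : ℕ → List Word
wordsOfLen zero = [] ∷ []
wordsOfLen (suc k) = map (false ∷_) (wordsOfLen k) ++ map (true ∷_) (wordsOfLen k)

wordsUpTo : ℕ → List Word
wordsUpTo k = concatMap wordsOfLen (upTo (suc k))

-- S_F(n) = #{ v ∈ L_F : binom (rep_F n) v > 0 }.
-- Any v with binom u v > 0 has length ≤ length u, so it suffices to
-- count over words of length ≤ length (rep_F n).
SF : ℕ → ℕ
SF n = length (filterᵇ (λ v → inLF v ∧ (0 <ᵇ binom (repF n) v))
                       (wordsUpTo (length (repF n))))

-- Write rep_F(n) = 1t with t ∈ {0,01}*, so that n < F(|t| + 1).  Every prefix of 1t lies in L_F,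
-- giving an L_F-subword of each length 0, …, |t| + 1, so S_F(n) ≥ |t| + 2 and n < F(S_F(n)).
-- Since rep_F(F(k)) = 10ᵏ, whose L_F-subwords are ε and the 10ʲ, S_F(F(k)) = k + 2.  Conversely, if
-- S_F(n) = k + 2 then |t| ≤ k: either |t| < k and n < F(k), or t = 0ᵏ and n = F(k), or t contains
-- a 1, which produces two L_F-subwords of the same length and forces S_F(n) ≥ k + 3.

module Submission where

open import Defs
open import Data.Bool using (Bool; true; false; T; _∧_)
open import Data.Bool.Properties using (T-∧; ∨-identityʳ)
open import Data.Empty using (⊥-elim)
open import Data.List using (List; []; _∷_; _++_; map; length; filterᵇ; concatMap; upTo; replicate; take)
open import Data.List.Properties using (length-++; length-map; length-replicate; length-upTo; length-take; filter-++; ∷-injectiveʳ)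
open import Data.List.Relation.Binary.Sublist.Propositional using (_⊆_; []; _∷_; _∷ʳ_; minimum; ⊆-refl)
open import Data.List.Relation.Binary.Sublist.Propositional.Properties using (length-mono-≤; take-⊆; ++⁺; ++⁺ʳ)
open import Data.List.Relation.Unary.All using (All; []; _∷_)
open import Data.List.Relation.Unary.All.Properties using (applyUpTo⁺₁)
open import Data.List.Relation.Unary.Any using (Any; here; there)
import Data.List.Relation.Unary.Any.Properties as Any
open import Data.Nat using (ℕ; zero; suc; _+_; _∸_; _≤_; _<_; _≤′_; ≤′-refl; ≤′-step; z≤n; s≤s; z<s; s<s; _≤ᵇ_; _<ᵇ_; >-nonZero)
open import Data.Nat.ListAction using (sum)
open import Data.Nat.Properties
open import Data.Product using (_×_; _,_; proj₁; proj₂; ∃; ∃₂)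
open import Data.Sum using (_⊎_; inj₁; inj₂; [_,_]′)
open import Function using (id; _∘_; case_of_; Equivalence)
open import Relation.Binary.PropositionalEquality
open import Relation.Nullary using (¬_; ofʸ; ofⁿ)
open import Relation.Nullary.Decidable using (T?)

private
  variable
    k m n : ℕ
    s t u v w : Word

-- Fibonacci numbers

F-pos : ∀ k → 0 < F k
F-pos zero = z<s
F-pos (suc zero) = z<s
F-pos (suc (suc k)) = <-≤-trans (F-pos (suc k)) (m≤m+n _ _)

F-<-suc : ∀ k → F k < F (suc k)
F-<-suc zero = s<s z<s
F-<-suc (suc k) = subst (_≤ F (suc k) + F k) (+-comm (F (suc k)) 1) (+-monoʳ-≤ (F (suc k)) (F-pos k))

F-mono-≤ : m ≤ n → F m ≤ F n
F-mono-≤ = go ∘ ≤⇒≤′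
  where
  go : m ≤′ n → F m ≤ F n
  go ≤′-refl = ≤-refl
  go (≤′-step {n} p) = ≤-trans (go p) (<⇒≤ (F-<-suc n))

F-mono-< : m < n → F m < F n
F-mono-< {m} m<n = <-≤-trans (F-<-suc m) (F-mono-≤ m<n)

n<F[n] : ∀ n → n < F n
n<F[n] zero = z<s
n<F[n] (suc zero) = s<s z<s
n<F[n] (suc (suc n)) = subst (_≤ F (suc n) + F n) (+-comm (suc (suc n)) 1) (+-mono-≤ (n<F[n] (suc n)) (F-pos n))

F[suc]≤2F : ∀ k → F (suc k) ≤ F k + F k
F[suc]≤2F zero = ≤-refl
F[suc]≤2F (suc k) = +-monoʳ-≤ (F (suc k)) (F-mono-≤ (n≤1+n k))

n<F[1+n] : ∀ n → n < F (suc n)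
n<F[1+n] n = <-trans (n<F[n] n) (F-<-suc n)

-- Zeckendorf representations

-- The language {0,01}*, so that L_F consists of ε and the words true ∷ t with Tail t.
data Tail : Word → Set where
  []   : Tail []
  0∷_  : Tail w → Tail (false ∷ w)
  01∷_ : Tail w → Tail (false ∷ true ∷ w)

Tail⇒inTail : Tail w → T (inTail w)
Tail⇒inTail [] = _
Tail⇒inTail (0∷ []) = _
Tail⇒inTail (0∷ p@(0∷ _)) = Tail⇒inTail p
Tail⇒inTail (0∷ p@(01∷ _)) = Tail⇒inTail p
Tail⇒inTail (01∷ p) = subst T (sym (∨-identityʳ _)) (Tail⇒inTail p)

Tail-take : Tail w → ∀ j → Tail (take j w)
Tail-take p zero = []
Tail-take [] (suc j) = []
Tail-take (0∷ p) (suc j) = 0∷ Tail-take p j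
Tail-take (01∷ p) (suc zero) = 0∷ []
Tail-take (01∷ p) (suc (suc j)) = 01∷ Tail-take p j

Tail-replicate : ∀ k → Tail (replicate k false)
Tail-replicate zero = []
Tail-replicate (suc k) = 0∷ Tail-replicate k

Tail-0ᵃ⁺¹1 : ∀ a → Tail s → Tail (replicate (suc a) false ++ true ∷ s)
Tail-0ᵃ⁺¹1 zero p = 01∷ p
Tail-0ᵃ⁺¹1 (suc a) p = 0∷ Tail-0ᵃ⁺¹1 a p

Tail-zeros⊎one : Tail t →
  t ≡ replicate (length t) false ⊎ ∃₂ λ a s → t ≡ replicate (suc a) false ++ true ∷ s × Tail s
Tail-zeros⊎one [] = inj₁ refl
Tail-zeros⊎one (0∷ p) with Tail-zeros⊎one p
... | inj₁ zeros = inj₁ (cong (false ∷_) zeros)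
... | inj₂ (a , s , t≡ , q) = inj₂ (suc a , s , cong (false ∷_) t≡ , q)
Tail-zeros⊎one (01∷ p) = inj₂ (0 , _ , refl , p)

value : Word → ℕ
value [] = 0
value (false ∷ w) = value w
value (true ∷ w) = F (length w) + value w

value-1∷0ᵏ : ∀ k → value (true ∷ replicate k false) ≡ F k
value-1∷0ᵏ k = trans (cong₂ _+_ (cong F (length-replicate k)) (value-0ᵏ k)) (+-identityʳ (F k))
  where
  value-0ᵏ : ∀ k → value (replicate k false) ≡ 0
  value-0ᵏ zero = refl
  value-0ᵏ (suc k) = value-0ᵏ k

value<F : Tail t → value t < F (length t)
value-1∷Tail<F : Tail t → value (true ∷ t) < F (suc (length t))

value<F [] = z<s
value<F (0∷_ {w} p) = <-≤-trans (value<F p) (<⇒≤ (F-<-suc (length w)))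
value<F (01∷_ {w} p) = <-≤-trans (value-1∷Tail<F p) (<⇒≤ (F-<-suc (suc (length w))))

value-1∷Tail<F [] = s<s z<s
value-1∷Tail<F (0∷ p) = +-monoʳ-< _ (value<F p)
value-1∷Tail<F (01∷ p) = +-monoʳ-< _ (value-1∷Tail<F p)

length-greedyDigits : ∀ ℓ n → length (greedyDigits ℓ n) ≡ ℓ
length-greedyDigits zero n = refl
length-greedyDigits (suc ℓ) n with F ℓ ≤ᵇ n
... | true = cong suc (length-greedyDigits ℓ (n ∸ F ℓ))
... | false = cong suc (length-greedyDigits ℓ n)

value-greedyDigits : ∀ ℓ n → n < F ℓ → value (greedyDigits ℓ n) ≡ n
value-greedyDigits zero zero _ = refl
value-greedyDigits zero (suc n) (s<s ())
value-greedyDigits (suc ℓ) n n<F with F ℓ ≤ᵇ n | ≤ᵇ-reflects-≤ (F ℓ) n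
... | true | ofʸ F≤n = begin
  F (length (greedyDigits ℓ (n ∸ F ℓ))) + value (greedyDigits ℓ (n ∸ F ℓ))
    ≡⟨ cong₂ _+_ (cong F (length-greedyDigits ℓ (n ∸ F ℓ))) (value-greedyDigits ℓ (n ∸ F ℓ) rest<F) ⟩
  F ℓ + (n ∸ F ℓ)  ≡⟨ m+[n∸m]≡n F≤n ⟩
  n                ∎
  where
  open ≡-Reasoning
  rest<F : n ∸ F ℓ < F ℓ
  rest<F = m<n+o⇒m∸n<o n (F ℓ) {{>-nonZero (F-pos ℓ)}} (<-≤-trans n<F (F[suc]≤2F ℓ))
... | false | ofⁿ F≰n = value-greedyDigits ℓ n (≰⇒> F≰n)

Canonical : Word → Set
Canonical w = Tail w ⊎ ∃ λ t → w ≡ true ∷ t × Tail t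

0∷-canonical : Canonical w → Tail (false ∷ w)
0∷-canonical (inj₁ p) = 0∷ p
0∷-canonical (inj₂ (_ , refl , p)) = 01∷ p

greedyDigits-canonical : ∀ ℓ n → n < F ℓ → Canonical (greedyDigits ℓ n)
greedyDigits-tail : ∀ ℓ n → n < F ℓ → Tail (greedyDigits (suc ℓ) n)

greedyDigits-canonical zero n _ = inj₁ []
greedyDigits-canonical (suc ℓ) n n<F with F ℓ ≤ᵇ n | ≤ᵇ-reflects-≤ (F ℓ) n
greedyDigits-canonical (suc zero) n n<F | true | ofʸ _ = inj₂ (_ , refl , [])
greedyDigits-canonical (suc (suc ℓ)) n n<F | true | ofʸ F≤n =
  inj₂ (_ , refl , greedyDigits-tail ℓ (n ∸ F (suc ℓ))
                      (m<n+o⇒m∸n<o n (F (suc ℓ)) {{>-nonZero (F-pos ℓ)}} n<F))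
... | false | ofⁿ F≰n = inj₁ (0∷-canonical (greedyDigits-canonical ℓ n (≰⇒> F≰n)))

greedyDigits-tail ℓ n n<F with F ℓ ≤ᵇ n | ≤ᵇ-reflects-≤ (F ℓ) n
... | true | ofʸ F≤n = ⊥-elim (<⇒≱ n<F F≤n)
... | false | _ = 0∷-canonical (greedyDigits-canonical ℓ n n<F)

value-dropLeadingZeros : ∀ w → value (dropLeadingZeros w) ≡ value w
value-dropLeadingZeros [] = refl
value-dropLeadingZeros (false ∷ w) = value-dropLeadingZeros w
value-dropLeadingZeros (true ∷ w) = refl

dropLeadingZeros-canonical : Canonical w →
  dropLeadingZeros w ≡ [] ⊎ ∃ λ t → dropLeadingZeros w ≡ true ∷ t × Tail t
dropLeadingZeros-canonical (inj₁ []) = inj₁ refl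
dropLeadingZeros-canonical (inj₁ (0∷ p)) = dropLeadingZeros-canonical (inj₁ p)
dropLeadingZeros-canonical (inj₁ (01∷ p)) = inj₂ (_ , refl , p)
dropLeadingZeros-canonical (inj₂ (t , refl , p)) = inj₂ (t , refl , p)

value-repF : ∀ n → value (repF n) ≡ n
value-repF n = trans (value-dropLeadingZeros (greedyDigits (suc n) n)) (value-greedyDigits (suc n) n (n<F[1+n] n))

repF-shape : ∀ n → n ≡ 0 ⊎ ∃ λ t → repF n ≡ true ∷ t × Tail t × value (true ∷ t) ≡ n
repF-shape n with dropLeadingZeros-canonical (greedyDigits-canonical (suc n) n (n<F[1+n] n))
... | inj₁ rep≡[] = inj₁ (trans (sym (value-repF n)) (cong value rep≡[]))
... | inj₂ (t , rep≡ , p) = inj₂ (t , rep≡ , p , trans (cong value (sym rep≡)) (value-repF n))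

greedyDigits-0 : ∀ k → greedyDigits k 0 ≡ replicate k false
greedyDigits-0 zero = refl
greedyDigits-0 (suc k) with F k ≤ᵇ 0 | ≤ᵇ-reflects-≤ (F k) 0
... | true | ofʸ F≤0 = ⊥-elim (<⇒≱ (F-pos k) F≤0)
... | false | _ = cong (false ∷_) (greedyDigits-0 k)

greedyDigits-F : ∀ d k → greedyDigits (suc (d + k)) (F k) ≡ replicate d false ++ true ∷ replicate k false
greedyDigits-F zero k with F k ≤ᵇ F k | ≤ᵇ-reflects-≤ (F k) (F k)
... | true | _ = cong (true ∷_) (trans (cong (greedyDigits k) (n∸n≡0 (F k))) (greedyDigits-0 k))
... | false | ofⁿ F≰F = ⊥-elim (F≰F ≤-refl)
greedyDigits-F (suc d) k with F (suc (d + k)) ≤ᵇ F k | ≤ᵇ-reflects-≤ (F (suc (d + k))) (F k)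
... | true | ofʸ F≤F = ⊥-elim (<⇒≱ (F-mono-< (s≤s (m≤n+m k d))) F≤F)
... | false | _ = cong (false ∷_) (greedyDigits-F d k)

dropLeadingZeros-0ᵈ1 : ∀ d → dropLeadingZeros (replicate d false ++ true ∷ w) ≡ true ∷ w
dropLeadingZeros-0ᵈ1 zero = refl
dropLeadingZeros-0ᵈ1 (suc d) = dropLeadingZeros-0ᵈ1 d

repF-F : ∀ k → repF (F k) ≡ true ∷ replicate k false
repF-F k = begin
  dropLeadingZeros (greedyDigits (suc (F k)) (F k))
    ≡⟨ cong (λ ℓ → dropLeadingZeros (greedyDigits (suc ℓ) (F k))) (m∸n+n≡m (<⇒≤ (n<F[n] k))) ⟨
  dropLeadingZeros (greedyDigits (suc (F k ∸ k + k)) (F k))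
    ≡⟨ cong dropLeadingZeros (greedyDigits-F (F k ∸ k) k) ⟩
  dropLeadingZeros (replicate (F k ∸ k) false ++ true ∷ replicate k false)
    ≡⟨ dropLeadingZeros-0ᵈ1 (F k ∸ k) ⟩
  true ∷ replicate k false ∎
  where open ≡-Reasoning

-- Scattered subwords

⊆-replicate : ∀ {A : Set} {x : A} {xs : List A} k → xs ⊆ replicate k x → xs ≡ replicate (length xs) x
⊆-replicate zero [] = refl
⊆-replicate (suc k) (_ ∷ʳ p) = ⊆-replicate k p
⊆-replicate (suc k) (refl ∷ p) = cong (_ ∷_) (⊆-replicate k p)

replicate-⊆ : ∀ {A : Set} {x : A} {j k} → j ≤ k → replicate j x ⊆ replicate k x
replicate-⊆ {k = k} z≤n = minimum (replicate k _)
replicate-⊆ (s≤s j≤k) = refl ∷ replicate-⊆ j≤k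

⊆⇒binom-pos : v ⊆ u → 0 < binom u v
⊆⇒binom-pos {v = []} _ = z<s
⊆⇒binom-pos {v = _ ∷ _} (_ ∷ʳ p) = ≤-trans (⊆⇒binom-pos p) (m≤m+n _ _)
⊆⇒binom-pos (_∷_ {x = true} refl p) = ≤-trans (⊆⇒binom-pos p) (m≤n+m _ _)
⊆⇒binom-pos (_∷_ {x = false} refl p) = ≤-trans (⊆⇒binom-pos p) (m≤n+m _ _)

positive-summand : 0 < m + n → 0 < m ⊎ 0 < n
positive-summand {zero} 0<n = inj₂ 0<n
positive-summand {suc m} _ = inj₁ z<s

binom-pos⇒⊆ : ∀ u v → 0 < binom u v → v ⊆ u
binom-pos⇒⊆ u [] _ = minimum u
binom-pos⇒⊆ (true ∷ u) (true ∷ v) pos =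
  [ (λ p → true ∷ʳ binom-pos⇒⊆ u (true ∷ v) p) , (λ p → refl ∷ binom-pos⇒⊆ u v p) ]′ (positive-summand pos)
binom-pos⇒⊆ (false ∷ u) (false ∷ v) pos =
  [ (λ p → false ∷ʳ binom-pos⇒⊆ u (false ∷ v) p) , (λ p → refl ∷ binom-pos⇒⊆ u v p) ]′ (positive-summand pos)
binom-pos⇒⊆ (true ∷ u) (false ∷ v) pos = true ∷ʳ binom-pos⇒⊆ u (false ∷ v) (subst (0 <_) (+-identityʳ _) pos)
binom-pos⇒⊆ (false ∷ u) (true ∷ v) pos = false ∷ʳ binom-pos⇒⊆ u (true ∷ v) (subst (0 <_) (+-identityʳ _) pos)

filterᵇ-map : ∀ {A B : Set} (P : B → Bool) (f : A → B) (xs : List A) →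
              filterᵇ P (map f xs) ≡ map f (filterᵇ (P ∘ f) xs)
filterᵇ-map P f [] = refl
filterᵇ-map P f (x ∷ xs) with P (f x)
... | true = cong (f x ∷_) (filterᵇ-map P f xs)
... | false = filterᵇ-map P f xs

length-filterᵇ-concatMap : ∀ {A B : Set} (P : B → Bool) (f : A → List B) (xs : List A) →
  length (filterᵇ P (concatMap f xs)) ≡ sum (map (length ∘ filterᵇ P ∘ f) xs)
length-filterᵇ-concatMap P f [] = refl
length-filterᵇ-concatMap P f (x ∷ xs) = begin
  length (filterᵇ P (f x ++ concatMap f xs))                 ≡⟨ cong length (filter-++ (T? ∘ P) (f x) _) ⟩
  length (filterᵇ P (f x) ++ filterᵇ P (concatMap f xs))     ≡⟨ length-++ (filterᵇ P (f x)) ⟩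
  length (filterᵇ P (f x)) + length (filterᵇ P (concatMap f xs))
    ≡⟨ cong (length (filterᵇ P (f x)) +_) (length-filterᵇ-concatMap P f xs) ⟩
  sum (map (length ∘ filterᵇ P ∘ f) (x ∷ xs))                ∎
  where open ≡-Reasoning

count : (Word → Bool) → ℕ → ℕ
count P m = length (filterᵇ P (wordsOfLen m))

count-suc : ∀ P m → count P (suc m) ≡ count (P ∘ (false ∷_)) m + count (P ∘ (true ∷_)) m
count-suc P m = begin
  length (filterᵇ P (map (false ∷_) W ++ map (true ∷_) W))
    ≡⟨ cong length (filter-++ (T? ∘ P) (map (false ∷_) W) _) ⟩
  length (filterᵇ P (map (false ∷_) W) ++ filterᵇ P (map (true ∷_) W))
    ≡⟨ length-++ (filterᵇ P (map (false ∷_) W)) ⟩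
  length (filterᵇ P (map (false ∷_) W)) + length (filterᵇ P (map (true ∷_) W))
    ≡⟨ cong₂ _+_ (count-prefixed false) (count-prefixed true) ⟩
  count (P ∘ (false ∷_)) m + count (P ∘ (true ∷_)) m ∎
  where
  open ≡-Reasoning
  W = wordsOfLen m
  count-prefixed : ∀ b → length (filterᵇ P (map (b ∷_) W)) ≡ count (P ∘ (b ∷_)) m
  count-prefixed b = trans (cong length (filterᵇ-map P (b ∷_) W)) (length-map (b ∷_) (filterᵇ (P ∘ (b ∷_)) W))

count-none : ∀ P → (∀ v → length v ≡ m → ¬ T (P v)) → count P m ≡ 0
count-none {zero} P none with P [] | none [] refl
... | true | ¬p = ⊥-elim (¬p _)
... | false | _ = refl
count-none {suc m} P none rewrite count-suc P m =
  cong₂ _+_ (count-none (P ∘ (false ∷_)) (λ v → none (false ∷ v) ∘ cong suc))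
            (count-none (P ∘ (true ∷_)) (λ v → none (true ∷ v) ∘ cong suc))

count-pos : ∀ P → length w ≡ m → T (P w) → 1 ≤ count P m
count-pos {w = []} P refl p with P [] | p
... | true | _ = ≤-refl
count-pos {w = false ∷ w} P refl p rewrite count-suc P (length w) =
  ≤-trans (count-pos (P ∘ (false ∷_)) refl p) (m≤m+n _ _)
count-pos {w = true ∷ w} P refl p rewrite count-suc P (length w) =
  ≤-trans (count-pos (P ∘ (true ∷_)) refl p) (m≤n+m _ _)

count-unique : ∀ P → length w ≡ m → T (P w) → (∀ v → length v ≡ m → T (P v) → v ≡ w) → count P m ≡ 1
count-unique {w = []} P refl p _ with P [] | p
... | true | _ = refl
count-unique {w = false ∷ w} P refl p unique rewrite count-suc P (length w) =
  cong₂ _+_ (count-unique (P ∘ (false ∷_)) refl p λ v e pv → ∷-injectiveʳ (unique (false ∷ v) (cong suc e) pv))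
            (count-none (P ∘ (true ∷_)) λ v e pv → case unique (true ∷ v) (cong suc e) pv of λ ())
count-unique {w = true ∷ w} P refl p unique rewrite count-suc P (length w) =
  cong₂ _+_ (count-none (P ∘ (false ∷_)) λ v e pv → case unique (false ∷ v) (cong suc e) pv of λ ())
            (count-unique (P ∘ (true ∷_)) refl p λ v e pv → ∷-injectiveʳ (unique (true ∷ v) (cong suc e) pv))

count-≥2 : ∀ P → length v ≡ m → length w ≡ m → v ≢ w → T (P v) → T (P w) → 2 ≤ count P m
count-≥2 {v = []} {w = []} P refl _ v≢w _ _ = ⊥-elim (v≢w refl)
count-≥2 {v = a ∷ v} {w = []} P refl () _ _ _
count-≥2 {v = false ∷ v} {w = false ∷ w} P refl e v≢w pv pw rewrite count-suc P (length v) =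
  ≤-trans (count-≥2 (P ∘ (false ∷_)) refl (suc-injective e) (v≢w ∘ cong (false ∷_)) pv pw) (m≤m+n _ _)
count-≥2 {v = true ∷ v} {w = true ∷ w} P refl e v≢w pv pw rewrite count-suc P (length v) =
  ≤-trans (count-≥2 (P ∘ (true ∷_)) refl (suc-injective e) (v≢w ∘ cong (true ∷_)) pv pw) (m≤n+m _ _)
count-≥2 {v = false ∷ v} {w = true ∷ w} P refl e _ pv pw rewrite count-suc P (length v) =
  +-mono-≤ (count-pos (P ∘ (false ∷_)) refl pv) (count-pos (P ∘ (true ∷_)) (suc-injective e) pw)
count-≥2 {v = true ∷ v} {w = false ∷ w} P refl e _ pv pw rewrite count-suc P (length v) =
  +-mono-≤ (count-pos (P ∘ (false ∷_)) (suc-injective e) pw) (count-pos (P ∘ (true ∷_)) refl pv)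

length≤sum : ∀ (g : ℕ → ℕ) {xs} → All (λ x → 1 ≤ g x) xs → length xs ≤ sum (map g xs)
length≤sum g [] = z≤n
length≤sum g (p ∷ ps) = +-mono-≤ p (length≤sum g ps)

length<sum : ∀ (g : ℕ → ℕ) {xs} → All (λ x → 1 ≤ g x) xs → Any (λ x → 2 ≤ g x) xs → length xs < sum (map g xs)
length<sum g (_ ∷ ps) (here q) = +-mono-≤ q (length≤sum g ps)
length<sum g (p ∷ ps) (there q) = +-mono-≤ p (length<sum g ps q)

sum≡length : ∀ (g : ℕ → ℕ) {xs} → All (λ x → g x ≡ 1) xs → sum (map g xs) ≡ length xs
sum≡length g [] = refl
sum≡length g (p ∷ ps) = cong₂ _+_ p (sum≡length g ps)

-- Counting L_F-subwords

isLFSubword : Word → Word → Bool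
isLFSubword u v = inLF v ∧ (0 <ᵇ binom u v)

S : Word → ℕ
S u = length (filterᵇ (isLFSubword u) (wordsUpTo (length u)))

isLFSubword-intro : T (inLF v) → v ⊆ u → T (isLFSubword u v)
isLFSubword-intro lf v⊆u = Equivalence.from T-∧ (lf , <⇒<ᵇ (⊆⇒binom-pos v⊆u))

isLFSubword-elim : ∀ u v → T (isLFSubword u v) → T (inLF v) × v ⊆ u
isLFSubword-elim u v p with Equivalence.to T-∧ p
... | lf , pos = lf , binom-pos⇒⊆ u v (<ᵇ⇒< 0 (binom u v) pos)

S-as-sum : ∀ u → S u ≡ sum (map (count (isLFSubword u)) (upTo (suc (length u))))
S-as-sum u = length-filterᵇ-concatMap (isLFSubword u) wordsOfLen (upTo (suc (length u)))

prefixes-counted : Tail t → All (λ j → 1 ≤ count (isLFSubword (true ∷ t)) j) (upTo (2 + length t))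
prefixes-counted {t} p = applyUpTo⁺₁ id _ prefix-counted
  where
  prefix-inLF : ∀ j → T (inLF (take j (true ∷ t)))
  prefix-inLF zero = _
  prefix-inLF (suc j) = Tail⇒inTail (Tail-take p j)
  prefix-counted : ∀ {j} → j < 2 + length t → 1 ≤ count (isLFSubword (true ∷ t)) j
  prefix-counted {j} j<2+t =
    count-pos {w = take j (true ∷ t)} (isLFSubword (true ∷ t))
      (trans (length-take j (true ∷ t)) (m≤n⇒m⊓n≡m (≤-pred j<2+t)))
      (isLFSubword-intro (prefix-inLF j) (take-⊆ j (true ∷ t)))

S-≥-prefixes : Tail t → 2 + length t ≤ S (true ∷ t)
S-≥-prefixes {t} p = begin
  2 + length t                        ≡⟨ length-upTo (2 + length t) ⟨
  length (upTo (2 + length t))        ≤⟨ length≤sum (count P) (prefixes-counted p) ⟩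
  sum (map (count P) (upTo (2 + length t)))  ≡⟨ S-as-sum (true ∷ t) ⟨
  S (true ∷ t)                        ∎
  where
  open ≤-Reasoning
  P = isLFSubword (true ∷ t)

S-≥-two-words : Tail t → T (inLF v) → v ⊆ true ∷ t → T (inLF w) → w ⊆ true ∷ t →
                v ≢ w → length v ≡ length w → 3 + length t ≤ S (true ∷ t)
S-≥-two-words {t} {v} {w} p lf-v v⊆ lf-w w⊆ v≢w |v|≡|w| = begin-strict
  2 + length t                        ≡⟨ length-upTo (2 + length t) ⟨
  length (upTo (2 + length t))        <⟨ length<sum (count P) (prefixes-counted p) twice ⟩
  sum (map (count P) (upTo (2 + length t)))  ≡⟨ S-as-sum (true ∷ t) ⟨
  S (true ∷ t)                        ∎
  where
  open ≤-Reasoning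
  P = isLFSubword (true ∷ t)
  twice : Any (λ j → 2 ≤ count P j) (upTo (2 + length t))
  twice = Any.applyUpTo⁺ id
    (count-≥2 P refl (sym |v|≡|w|) v≢w (isLFSubword-intro lf-v v⊆) (isLFSubword-intro lf-w w⊆))
    (s≤s (length-mono-≤ v⊆))

S-1∷0ᵏ : ∀ k → S (true ∷ replicate k false) ≡ 2 + k
S-1∷0ᵏ k = begin
  S 1∷0ᵏ                                                   ≡⟨ S-as-sum 1∷0ᵏ ⟩
  sum (map (count P) (upTo (2 + length (replicate k false))))
    ≡⟨ sum≡length (count P) (applyUpTo⁺₁ id _ one-word) ⟩
  length (upTo (2 + length (replicate k false)))        ≡⟨ length-upTo _ ⟩
  2 + length (replicate k false)                        ≡⟨ cong (2 +_) (length-replicate k) ⟩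
  2 + k                                                 ∎
  where
  open ≡-Reasoning
  1∷0ᵏ = true ∷ replicate k false
  P = isLFSubword 1∷0ᵏ
  unique : ∀ j v → length v ≡ suc j → T (P v) → v ≡ true ∷ replicate j false
  unique j (false ∷ v) _ pv = ⊥-elim (proj₁ (isLFSubword-elim 1∷0ᵏ (false ∷ v) pv))
  unique j (true ∷ v) |v|≡1+j pv with proj₂ (isLFSubword-elim 1∷0ᵏ (true ∷ v) pv)
  ... | _ ∷ʳ p = case ⊆-replicate k p of λ ()
  ... | refl ∷ p = cong (true ∷_) (trans (⊆-replicate k p) (cong (λ n → replicate n false) (suc-injective |v|≡1+j)))
  one-word : ∀ {j} → j < 2 + length (replicate k false) → count P j ≡ 1
  one-word {zero} _ = count-unique {w = []} P refl _ λ { [] _ _ → refl }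
  one-word {suc j} j<2+k =
    count-unique P (cong suc (length-replicate j))
      (isLFSubword-intro (Tail⇒inTail (Tail-replicate j)) (refl ∷ replicate-⊆ j≤k)) (unique j)
    where
    j≤k : j ≤ k
    j≤k = subst (j ≤_) (length-replicate k) (≤-pred (≤-pred j<2+k))

replicate-suc≢replicate∷ʳ : ∀ b → replicate (suc b) false ≢ replicate b false ++ true ∷ []
replicate-suc≢replicate∷ʳ zero ()
replicate-suc≢replicate∷ʳ (suc b) e = replicate-suc≢replicate∷ʳ b (∷-injectiveʳ e)

-- A word 1t of L_F containing a second 1 has two L_F-subwords of one length: 100 and 101 if t = 010…,
-- and 10ᵃ⁺¹ and 10ᵃ1 if t = 0ᵃ⁺¹1… with a ≥ 1.
S-≥-with-one : ∀ a {s} → Tail s → 3 ≤ length (replicate (suc a) false ++ true ∷ s) →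
  3 + length (replicate (suc a) false ++ true ∷ s) ≤ S (true ∷ replicate (suc a) false ++ true ∷ s)
S-≥-with-one zero {[]} _ (s≤s (s≤s ()))
S-≥-with-one zero {false ∷ s} p _ =
  S-≥-two-words {v = true ∷ false ∷ true ∷ []} {w = true ∷ false ∷ false ∷ []} (01∷ p)
    _ (refl ∷ refl ∷ refl ∷ minimum _)
    _ (refl ∷ refl ∷ true ∷ʳ refl ∷ minimum _)
    (λ ()) refl
S-≥-with-one (suc b) {s} p _ =
  S-≥-two-words {v = true ∷ replicate (2 + b) false} {w = true ∷ replicate (suc b) false ++ true ∷ []}
    (Tail-0ᵃ⁺¹1 (suc b) p)
    (Tail⇒inTail (Tail-replicate (2 + b))) (refl ∷ refl ∷ refl ∷ ++⁺ʳ (true ∷ s) ⊆-refl)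
    (Tail⇒inTail (Tail-0ᵃ⁺¹1 b [])) (refl ∷ refl ∷ false ∷ʳ ++⁺ ⊆-refl (refl ∷ minimum s))
    (replicate-suc≢replicate∷ʳ b ∘ ∷-injectiveʳ ∘ ∷-injectiveʳ)
    (cong (2 +_) (sym (trans (length-++ (replicate b false)) (+-comm _ 1))))

value<F[S] : Tail t → value (true ∷ t) < F (S (true ∷ t))
value<F[S] p = <-≤-trans (value-1∷Tail<F p) (F-mono-≤ (≤-trans (n≤1+n _) (S-≥-prefixes p)))

value≤F : 3 ≤ k → Tail t → S (true ∷ t) ≡ 2 + k → value (true ∷ t) ≤ F k
value≤F {k} {t} 3≤k p S≡2+k with m≤n⇒m<n∨m≡n |t|≤k
  where
  |t|≤k : length t ≤ k
  |t|≤k = ≤-pred (≤-pred (subst (2 + length t ≤_) S≡2+k (S-≥-prefixes p)))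
... | inj₁ |t|<k = <⇒≤ (<-≤-trans (value-1∷Tail<F p) (F-mono-≤ |t|<k))
... | inj₂ refl with Tail-zeros⊎one p
...   | inj₁ t≡0ᵏ = ≤-reflexive (trans (cong (value ∘ (true ∷_)) t≡0ᵏ) (value-1∷0ᵏ (length t)))
...   | inj₂ (a , s , refl , q) = ⊥-elim (<-irrefl refl (subst (3 + length t ≤_) S≡2+k (S-≥-with-one a q 3≤k)))

n≤F[SF[n]] : ∀ n → n ≤ F (SF n)
n≤F[SF[n]] n with repF-shape n
... | inj₁ refl = z≤n
... | inj₂ (t , rep≡ , p , refl) = <⇒≤ (subst (λ w → value (true ∷ t) < F (S w)) (sym rep≡) (value<F[S] p))

SF≡2+k⇒n≤F[k] : 3 ≤ k → SF n ≡ 2 + k → n ≤ F k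
SF≡2+k⇒n≤F[k] {n = n} 3≤k SF≡2+k with repF-shape n
... | inj₁ refl = z≤n
... | inj₂ (t , rep≡ , p , refl) = value≤F 3≤k p (trans (cong S (sym rep≡)) SF≡2+k)

SF[F[k]] : ∀ k → SF (F k) ≡ 2 + k
SF[F[k]] k = trans (cong S (repF-F k)) (S-1∷0ᵏ k)

proposition10p2 :
    ((i : ℕ) → 1 ≤ i → ∃ λ B → (n : ℕ) → SF n ≡ i → n ≤ B)
    × ((i : ℕ) → 5 ≤ i →
        (SF (F (i ∸ 2)) ≡ i) × ((n : ℕ) → SF n ≡ i → n ≤ F (i ∸ 2)))
proposition10p2 =
  (λ i _ → F i , λ n SF≡i → subst (λ j → n ≤ F j) SF≡i (n≤F[SF[n]] n)) ,
  λ { (suc (suc k)) (s≤s (s≤s 3≤k)) → SF[F[k]] k , λ n → SF≡2+k⇒n≤F[k] 3≤k }
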